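{- Let $G$ be a bridgeless graph with $m$ edges having vertices $v_1$ and $v_2$ joined by $k\ge 3$ parallel edges. Suppose that the degrees of $v_1$ and $v_2$ are both $k+1$, and the graph $G'$ obtained by contracting all the edges between $v_1$ and $v_2$ and suppressing the resulting vertex of degree two has a cycle cover with three cycles of total length at most $44(m-k-1)/27$. Then $G$ has a cycle cover with three cycles of total length at most $44m/27$.
   Context: Graphs may have loops and parallel edges. Contracting an edge $e$ identifies its end-vertices, removes $e$, and keeps all other edges; contracting a loop means deleting it. Suppressing a vertex $v$ of degree two means replacing the two-edge path through $v$ by a single edge. A cycle is a subgraph with all degrees even (possibly empty). A cycle cover is a collection of cycles such that every edge lies in at least one of them; its (total) length is the sum of the numbers of edges of its cycles. A graph is bridgeless if it has no edge-cut of size one. -}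

module Defs where

open import Data.Nat using (ℕ; zero; suc; _+_; _*_; _≤_)
open import Data.Nat.Divisibility using (_∣_)
open import Data.Bool using (Bool; true; false; if_then_else_; not; _∧_; _∨_; _xor_; T)
open import Data.Fin using (Fin; zero; suc; _≟_; punchOut)
open import Data.List using (List; length; lookup; filterᵇ; allFin)
open import Data.Sum using (_⊎_)
open import Data.Product using (_×_; _,_; proj₁; proj₂; Σ-syntax)
open import Relation.Nullary using (¬_; yes; no)
open import Relation.Nullary.Decidable using (⌊_⌋)
open import Relation.Binary.PropositionalEquality using (_≡_; _≢_; sym)

-- Finite multigraphs (loops and parallel edges allowed).
-- The ordered pair is only a presentation; all notions below are
-- symmetric in the two ends.

Graph : ℕ → ℕ → Set
Graph n m = Fin m → Fin n × Fin n

sumFin : (m : ℕ) → (Fin m → ℕ) → ℕ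
sumFin zero    f = 0
sumFin (suc m) f = f zero + sumFin m (λ i → f (suc i))

_==_ : ∀ {n} → Fin n → Fin n → Bool
i == j = ⌊ i ≟ j ⌋

b2n : Bool → ℕ
b2n true  = 1
b2n false = 0

-- number of ends of edge e at v (a loop at v counts 2)
incidence : ∀ {n m} → Graph n m → Fin n → Fin m → ℕ
incidence G v e = b2n (proj₁ (G e) == v) + b2n (proj₂ (G e) == v)

degree : ∀ {n m} → Graph n m → Fin n → ℕ
degree {m = m} G v = sumFin m (incidence G v)

joins : ∀ {n m} → Graph n m → Fin n → Fin n → Fin m → Bool
joins G a b e = ((proj₁ (G e) == a) ∧ (proj₂ (G e) == b))
              ∨ ((proj₁ (G e) == b) ∧ (proj₂ (G e) == a))

multiplicity : ∀ {n m} → Graph n m → Fin n → Fin n → ℕ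
multiplicity {m = m} G a b = sumFin m (λ e → b2n (joins G a b e))

EdgeSet : ℕ → Set
EdgeSet m = Fin m → Bool

size : ∀ {m} → EdgeSet m → ℕ
size {m} C = sumFin m (λ e → b2n (C e))

-- a cycle: spanning subgraph (edge set) with all degrees even (may be empty)
IsCycle : ∀ {n m} → Graph n m → EdgeSet m → Set
IsCycle {m = m} G C =
  ∀ v → 2 ∣ sumFin m (λ e → if C e then incidence G v e else 0)

-- G has a cycle cover consisting of three cycles of total length ℓ
-- with 27 * ℓ ≤ L  (i.e. ℓ ≤ L / 27)
HasCover3 : ∀ {n m} → Graph n m → ℕ → Set
HasCover3 {m = m} G L =
  Σ[ C₁ ∈ EdgeSet m ] Σ[ C₂ ∈ EdgeSet m ] Σ[ C₃ ∈ EdgeSet m ]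
    IsCycle G C₁ × IsCycle G C₂ × IsCycle G C₃ ×
    (∀ e → T (C₁ e ∨ C₂ e ∨ C₃ e)) ×
    (27 * (size C₁ + size C₂ + size C₃) ≤ L)

-- bridgeless: no edge-cut δ(S) has exactly one edge
Bridgeless : ∀ {n m} → Graph n m → Set
Bridgeless {n} {m} G =
  (S : Fin n → Bool) →
  ¬ (sumFin m (λ e → b2n (S (proj₁ (G e)) xor S (proj₂ (G e)))) ≡ 1)

kept : ∀ m → (Fin m → Bool) → List (Fin m)
kept m p = filterᵇ p (allFin m)

restrict : ∀ {n m} → Graph n m → (p : Fin m → Bool) → Graph n (length (kept m p))
restrict {m = m} G p j = G (lookup (kept m p) j)

mapV : ∀ {n n' m} → (Fin n → Fin n') → Graph n m → Graph n' m
mapV f G e = f (proj₁ (G e)) , f (proj₂ (G e))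

merge : ∀ {n} (a b : Fin (suc n)) → a ≢ b → Fin (suc n) → Fin n
merge a b a≢b i with i ≟ b
... | yes _   = punchOut {i = b} {j = a} (λ eq → a≢b (sym eq))
... | no i≢b  = punchOut {i = b} {j = i} (λ eq → i≢b (sym eq))

-- Contracting all edges between a and b (a ≢ b): contracting the first
-- such edge identifies a and b and removes it; the remaining ones have
-- become loops, and contracting a loop deletes it.
contractBetween : ∀ {n m} (G : Graph (suc n) m) (a b : Fin (suc n)) → a ≢ b →
                  Graph n (length (kept m (λ e → not (joins G a b e))))
contractBetween G a b a≢b =
  mapV (merge a b a≢b) (restrict G (λ e → not (joins G a b e)))

-- the end of edge e other than w (meaningful when e is incident to w)
otherEnd : ∀ {n m} → Graph n m → Fin n → Fin m → Fin n
otherEnd G w e with proj₁ (G e) == w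
... | true  = proj₂ (G e)
... | false = proj₁ (G e)

Incident : ∀ {n m} → Graph n m → Fin n → Fin m → Set
Incident G w e = (proj₁ (G e) ≡ w) ⊎ (proj₂ (G e) ≡ w)

-- delete vertex w; d is a default target for w itself (never used
-- when no remaining edge is incident to w)
removeV : ∀ {n} (w : Fin (suc n)) → Fin n → Fin (suc n) → Fin n
removeV w d i with i ≟ w
... | yes _   = d
... | no i≢w  = punchOut {i = w} {j = i} (λ eq → i≢w (sym eq))

addEdge : ∀ {n m} → Graph n m → Fin n × Fin n → Graph n (suc m)
addEdge G uv zero    = uv
addEdge G uv (suc e) = G e

suppress : ∀ {n m} (H : Graph (suc n) m) (w : Fin (suc n)) (e₁ e₂ : Fin m) →
           otherEnd H w e₁ ≢ w →
           Graph n (suc (length (kept m (λ e → not (e == e₁) ∧ not (e == e₂)))))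
suppress H w e₁ e₂ u≢w =
  addEdge (mapV rm (restrict H (λ e → not (e == e₁) ∧ not (e == e₂))))
          (rm (otherEnd H w e₁) , rm (otherEnd H w e₂))
  where
  rm = removeV w (punchOut {i = w} {j = otherEnd H w e₁} (λ eq → u≢w (sym eq)))

module Submission where

-- G' arises from G by contracting the k parallel edges between v₁ and v₂
-- into a vertex w and suppressing w, whose two edges e₁, e₂ (coming from
-- edges f₁, f₂ of G) become one new edge.  Since v₁, v₂ have degree
-- k + 1, each of f₁, f₂ has one end in {v₁, v₂}, and no other edge of G'
-- meets v₁ or v₂.  So a cycle of G' lifts to G by giving f₁, f₂ the flag
-- of the new edge, keeping all other edges, and adding a set of parallel
-- edges; it stays even at v₁, v₂ iff that set has the parity of the new
-- edge's flag, and elsewhere its degrees are those of G'.  Naming two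
-- parallel edges a, b, the added sets are described by selectors (is the
-- edge a? is it b?), and a purely arithmetic "plan" picks selectors for
-- the three cycles that cover all parallel edges, fix the parities, and
-- add at most 44/27 (k + 1) to the length.  As m = (m − k − 1) + (k + 1),
-- this gives the bound 44 m / 27.

open import Defs
open import Data.Nat using (ℕ; zero; suc; _+_; _*_; _∸_; _≤_; s≤s; s≤s⁻¹; >-nonZero)
open import Data.Nat.Properties
  using (+-comm; +-identityʳ; +-cancelˡ-≡; +-cancelʳ-≡; m+n≡0⇒m≡0; m+n≡0⇒n≡0; m≤m+n; m≤n+m;
         ≤-trans; n≤1+n; *-monoʳ-≤; +-mono-≤; m+n∸m≡n; +-commutativeSemigroup; module ≤-Reasoning)
open import Algebra.Properties.CommutativeSemigroup +-commutativeSemigroup using (interchange; xy∙z≈xz∙y)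
open import Data.Nat.Divisibility using (_∣_; ∣m∣n⇒∣m+n; ∣⇒≤; ∣-refl; _∣0)
open import Data.Nat.Tactic.RingSolver using (solve-∀)
open import Data.Bool using (Bool; true; false; if_then_else_; not; _∧_; _∨_; T)
open import Data.Bool.Properties using (∨-assoc; ∨-comm; ∧-identityʳ; ∧-zeroʳ; T-≡; T-∨; T-∧)
open import Data.Fin using (Fin; zero; suc; _≟_; punchOut)
open import Data.Fin.Properties using (punchOut-injective; punchOut-cong; suc-injective)
open import Data.List using (List; []; _∷_; length; lookup; filterᵇ; allFin; tabulate)
open import Data.List.Relation.Unary.Any as Any using ()
open import Data.List.Relation.Unary.Any.Properties using (lookup-index)
open import Data.List.Relation.Unary.All as All using ()
open import Data.List.Relation.Unary.AllPairs using (_∷_)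
open import Data.List.Relation.Unary.Unique.Propositional using (Unique)
open import Data.List.Relation.Unary.Unique.Propositional.Properties using (allFin⁺; filter⁺)
open import Data.List.Membership.Propositional.Properties using (∈-filter⁺; ∈-filter⁻; ∈-allFin; ∈-lookup)
open import Data.Unit using (tt)
open import Data.Empty using (⊥; ⊥-elim)
open import Data.Product using (_×_; _,_; proj₁; proj₂; Σ-syntax)
open import Data.Sum using (_⊎_; inj₁; inj₂)
open import Function using (_∘_; Equivalence)
open import Relation.Nullary using (yes; no; Dec)
open import Relation.Nullary.Decidable using (T?; isYes≗does; dec-true; dec-false; toWitness)
open import Relation.Binary.PropositionalEquality

==-refl : ∀ {n} (i : Fin n) → (i == i) ≡ true
==-refl i = trans (isYes≗does (i ≟ i)) (dec-true (i ≟ i) refl)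

==-false : ∀ {n} {i j : Fin n} → i ≢ j → (i == j) ≡ false
==-false {i = i} {j} i≢j = trans (isYes≗does (i ≟ j)) (dec-false (i ≟ j) i≢j)

==-sound : ∀ {n} {i j : Fin n} → (i == j) ≡ true → i ≡ j
==-sound {i = i} {j} eq = toWitness {a? = i ≟ j} (Equivalence.from T-≡ eq)

sumFin-cong : ∀ m {f g : Fin m → ℕ} → (∀ i → f i ≡ g i) → sumFin m f ≡ sumFin m g
sumFin-cong zero    eq = refl
sumFin-cong (suc m) eq = cong₂ _+_ (eq zero) (sumFin-cong m (eq ∘ suc))

sumFin-+ : ∀ m (f g : Fin m → ℕ) → sumFin m (λ i → f i + g i) ≡ sumFin m f + sumFin m g
sumFin-+ zero    f g = refl
sumFin-+ (suc m) f g =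
  trans (cong (f zero + g zero +_) (sumFin-+ m (f ∘ suc) (g ∘ suc)))
        (interchange (f zero) (g zero) (sumFin m (f ∘ suc)) (sumFin m (g ∘ suc)))

sumFin-zero : ∀ m (f : Fin m → ℕ) → (∀ i → f i ≡ 0) → sumFin m f ≡ 0
sumFin-zero zero    f f≡0 = refl
sumFin-zero (suc m) f f≡0 rewrite f≡0 zero = sumFin-zero m (f ∘ suc) (f≡0 ∘ suc)

sumFin-zero⁻ : ∀ m (f : Fin m → ℕ) → sumFin m f ≡ 0 → ∀ i → f i ≡ 0
sumFin-zero⁻ (suc m) f eq zero    = m+n≡0⇒m≡0 (f zero) eq
sumFin-zero⁻ (suc m) f eq (suc i) = sumFin-zero⁻ m (f ∘ suc) (m+n≡0⇒n≡0 (f zero) eq) i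

sumFin-const : ∀ m → sumFin m (λ _ → 1) ≡ m
sumFin-const zero    = refl
sumFin-const (suc m) = cong suc (sumFin-const m)

sumFin-point : ∀ m (f : Fin m → ℕ) a → (∀ i → i ≢ a → f i ≡ 0) → sumFin m f ≡ f a
sumFin-point (suc m) f zero    off =
  trans (cong (f zero +_) (sumFin-zero m (f ∘ suc) (λ i → off (suc i) (λ ())))) (+-identityʳ _)
sumFin-point (suc m) f (suc a) off rewrite off zero (λ ()) =
  sumFin-point m (f ∘ suc) a (λ i i≢a → off (suc i) (i≢a ∘ suc-injective))

sumFin-indicator : ∀ m (f : Fin m → ℕ) a → sumFin m (λ i → if i == a then f i else 0) ≡ f a
sumFin-indicator m f a =
  trans (sumFin-point m _ a (λ i i≢a → cong (λ t → if t then f i else 0) (==-false i≢a)))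
        (cong (λ t → if t then f a else 0) (==-refl a))

sumFin-split : ∀ m (p : Fin m → Bool) (f : Fin m → ℕ) →
  sumFin m f ≡ sumFin m (λ e → if p e then f e else 0) + sumFin m (λ e → if p e then 0 else f e)
sumFin-split m p f = trans (sumFin-cong m piece) (sumFin-+ m _ _)
  where
  piece : ∀ e → f e ≡ (if p e then f e else 0) + (if p e then 0 else f e)
  piece e with p e
  ... | true  = sym (+-identityʳ _)
  ... | false = refl

if-zero : ∀ c {x} → x ≡ 0 → (if c then x else 0) ≡ 0
if-zero true  x≡0 = x≡0
if-zero false _   = refl

if-one : ∀ c → (if c then 1 else 0) ≡ b2n c
if-one true  = refl
if-one false = refl

if-two : ∀ c → (if c then 2 else 0) ≡ b2n c + b2n c
if-two true  = refl
if-two false = refl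

if-+ : ∀ c x y → (if c then x else 0) + (if c then y else 0) ≡ (if c then x + y else 0)
if-+ true  x y = refl
if-+ false x y = refl

count-∧ : ∀ m (f : Fin m → Bool) s → sumFin m (λ e → b2n (f e ∧ s)) ≡ (if s then sumFin m (b2n ∘ f) else 0)
count-∧ m f true  = sumFin-cong m (λ e → cong b2n (∧-identityʳ (f e)))
count-∧ m f false = sumFin-zero m _ (λ e → cong b2n (∧-zeroʳ (f e)))

weight : ∀ {m} → EdgeSet m → (Fin m → ℕ) → ℕ
weight {m} C g = sumFin m (λ e → if C e then g e else 0)

size≡weight : ∀ {m} (C : EdgeSet m) → size C ≡ weight C (λ _ → 1)
size≡weight {m} C = sumFin-cong m (λ e → sym (if-one (C e)))

-- Sums over a list of indices; used to compare a sum over the kept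
-- edges (re-indexed by position) with a filtered sum over all edges.
sumList : ∀ {m} → List (Fin m) → (Fin m → ℕ) → ℕ
sumList []       f = 0
sumList (x ∷ xs) f = f x + sumList xs f

sumList-lookup : ∀ {m} (xs : List (Fin m)) f → sumFin (length xs) (f ∘ lookup xs) ≡ sumList xs f
sumList-lookup []       f = refl
sumList-lookup (x ∷ xs) f = cong (f x +_) (sumList-lookup xs f)

sumList-tabulate : ∀ {m} k (h : Fin k → Fin m) f → sumList (tabulate h) f ≡ sumFin k (f ∘ h)
sumList-tabulate zero    h f = refl
sumList-tabulate (suc k) h f = cong (f (h zero) +_) (sumList-tabulate k (h ∘ suc) f)

sumList-filter : ∀ {m} (p : Fin m → Bool) xs f →
  sumList (filterᵇ p xs) f ≡ sumList xs (λ e → if p e then f e else 0)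
sumList-filter p []       f = refl
sumList-filter p (x ∷ xs) f with p x
... | true  = cong (f x +_) (sumList-filter p xs f)
... | false = sumList-filter p xs f

lookup-injective : ∀ {m} {xs : List (Fin m)} → Unique xs → ∀ i j → lookup xs i ≡ lookup xs j → i ≡ j
lookup-injective (_ ∷ _)      zero    zero    eq = refl
lookup-injective (x∉xs ∷ _)   zero    (suc j) eq = ⊥-elim (All.lookup x∉xs (∈-lookup j) eq)
lookup-injective (x∉xs ∷ _)   (suc i) zero    eq = ⊥-elim (All.lookup x∉xs (∈-lookup i) (sym eq))
lookup-injective (_ ∷ uniq)   (suc i) (suc j) eq = cong suc (lookup-injective uniq i j eq)

-- The edges kept by a predicate p, indexed by their position ι i in
-- kept m p.  These are the edges of restrict G p.
module Kept (m : ℕ) (p : Fin m → Bool) where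

  ι : Fin (length (kept m p)) → Fin m
  ι = lookup (kept m p)

  ι-kept : ∀ i → p (ι i) ≡ true
  ι-kept i = Equivalence.to T-≡ (proj₂ (∈-filter⁻ (T? ∘ p) {xs = allFin m} (∈-lookup i)))

  ι-injective : ∀ i j → ι i ≡ ι j → i ≡ j
  ι-injective = lookup-injective (filter⁺ (T? ∘ p) (allFin⁺ m))

  position : (e : Fin m) → p e ≡ true → Fin (length (kept m p))
  position e pe = Any.index (∈-filter⁺ (T? ∘ p) (∈-allFin e) (Equivalence.from T-≡ pe))

  ι-position : ∀ e pe → ι (position e pe) ≡ e
  ι-position e pe = sym (lookup-index (∈-filter⁺ (T? ∘ p) (∈-allFin e) (Equivalence.from T-≡ pe)))

  extendAt : EdgeSet (length (kept m p)) → (e : Fin m) (b : Bool) → p e ≡ b → Bool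
  extendAt D e true  pe = D (position e pe)
  extendAt D e false _  = false

  extend : EdgeSet (length (kept m p)) → EdgeSet m
  extend D e = extendAt D e (p e) refl

  extend-ι : ∀ D i → extend D (ι i) ≡ D i
  extend-ι D i = at (p (ι i)) refl
    where
    at : (b : Bool) (pe : p (ι i) ≡ b) → extendAt D (ι i) b pe ≡ D i
    at true  pe = cong D (ι-injective _ _ (ι-position (ι i) pe))
    at false pe with () ← trans (sym pe) (ι-kept i)

  sum-filtered : ∀ f → sumFin m (λ e → if p e then f e else 0) ≡ sumFin (length (kept m p)) (f ∘ ι)
  sum-filtered f = sym (trans (sumList-lookup (kept m p) f)
                       (trans (sumList-filter p (allFin m) f) (sumList-tabulate m (λ i → i) _)))

  sum-split : ∀ f → sumFin m f ≡ sumFin (length (kept m p)) (f ∘ ι) + sumFin m (λ e → if p e then 0 else f e)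
  sum-split f = trans (sumFin-split m p f) (cong (_+ sumFin m (λ e → if p e then 0 else f e)) (sum-filtered f))

both-== : ∀ {n} {x y a b : Fin n} → T ((x == a) ∧ (y == b)) → x ≡ a × y ≡ b
both-== {x = x} {y} {a} {b} t with Equivalence.to T-∧ t
... | tx , ty = toWitness {a? = x ≟ a} tx , toWitness {a? = y ≟ b} ty

joins-ends : ∀ {n m} (G : Graph n m) a b e → joins G a b e ≡ true →
  (proj₁ (G e) ≡ a × proj₂ (G e) ≡ b) ⊎ (proj₁ (G e) ≡ b × proj₂ (G e) ≡ a)
joins-ends G a b e j with Equivalence.to T-∨ (Equivalence.from T-≡ j)
... | inj₁ t = inj₁ (both-== t)
... | inj₂ t = inj₂ (both-== t)

incidence-joins : ∀ {n m} (G : Graph n m) a b e v → joins G a b e ≡ true →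
  incidence G v e ≡ b2n (a == v) + b2n (b == v)
incidence-joins G a b e v j with joins-ends G a b e j
... | inj₁ (x≡a , y≡b) rewrite x≡a | y≡b = refl
... | inj₂ (x≡b , y≡a) rewrite x≡b | y≡a = +-comm (b2n (b == v)) (b2n (a == v))

-- A map that agrees with punchOut b away from b is injective there.
-- Both merge and removeV are of this form.
AgreesWithPunchOut : ∀ {n} → Fin (suc n) → (Fin (suc n) → Fin n) → Set
AgreesWithPunchOut b f = ∀ x (x≢b : x ≢ b) → f x ≡ punchOut (x≢b ∘ sym)

punchOut-like-injective : ∀ {n} {b : Fin (suc n)} {f} → AgreesWithPunchOut b f →
  ∀ {x y} → x ≢ b → y ≢ b → f x ≡ f y → x ≡ y
punchOut-like-injective agree {x} {y} x≢b y≢b fx≡fy =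
  punchOut-injective (x≢b ∘ sym) (y≢b ∘ sym) (trans (sym (agree x x≢b)) (trans fx≡fy (agree y y≢b)))

merge-agrees : ∀ {n} (a b : Fin (suc n)) (a≢b : a ≢ b) → AgreesWithPunchOut b (merge a b a≢b)
merge-agrees a b a≢b x x≢b with x ≟ b
... | yes x≡b = ⊥-elim (x≢b x≡b)
... | no  _   = punchOut-cong b refl

removeV-agrees : ∀ {n} (w : Fin (suc n)) d → AgreesWithPunchOut w (removeV w d)
removeV-agrees w d x x≢w with x ≟ w
... | yes x≡w = ⊥-elim (x≢w x≡w)
... | no  _   = punchOut-cong w refl

merge-fibre : ∀ {n} (a b : Fin (suc n)) (a≢b : a ≢ b) x →
  merge a b a≢b x ≡ merge a b a≢b a → x ≡ a ⊎ x ≡ b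
merge-fibre a b a≢b x eq = by-cases (x ≟ b)
  where
  by-cases : Dec (x ≡ b) → x ≡ a ⊎ x ≡ b
  by-cases (yes x≡b) = inj₂ x≡b
  by-cases (no  x≢b) = inj₁ (punchOut-like-injective (merge-agrees a b a≢b) x≢b a≢b eq)

otherEnd-of-fst : ∀ {n m} (G : Graph n m) w e → proj₁ (G e) ≡ w → otherEnd G w e ≡ proj₂ (G e)
otherEnd-of-fst G w e x≡w with proj₁ (G e) == w in test
... | true  = refl
... | false with () ← trans (sym test) (trans (cong (_== w) x≡w) (==-refl w))

otherEnd-of-snd : ∀ {n m} (G : Graph n m) w e → proj₁ (G e) ≢ w → otherEnd G w e ≡ proj₁ (G e)
otherEnd-of-snd G w e x≢w with proj₁ (G e) == w in test
... | true  = ⊥-elim (x≢w (==-sound test))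
... | false = refl

one-witness : ∀ m (f : Fin m → Bool) → 1 ≤ sumFin m (b2n ∘ f) → Σ[ a ∈ Fin m ] f a ≡ true
one-witness (suc m) f count with f zero in fa
... | true  = zero , fa
... | false with one-witness m (f ∘ suc) count
...   | a , fa' = suc a , fa'

two-witnesses : ∀ m (f : Fin m → Bool) → 2 ≤ sumFin m (b2n ∘ f) →
  Σ[ a ∈ Fin m ] Σ[ b ∈ Fin m ] a ≢ b × f a ≡ true × f b ≡ true
two-witnesses (suc m) f count with f zero in fa
... | true with one-witness m (f ∘ suc) (s≤s⁻¹ count)
...   | b , fb = zero , suc b , (λ ()) , fa , fb
two-witnesses (suc m) f count | false with two-witnesses m (f ∘ suc) count
...   | a , b , a≢b , fa' , fb = suc a , suc b , a≢b ∘ suc-injective , fa' , fb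

-- Choosing parallel edges.  Given two distinguished parallel edges a
-- and b, a selector decides whether to take a parallel edge e from
-- the pair (e is a, e is b).
Selector : Set
Selector = Bool → Bool → Bool

everything allButA allButAB onlyA onlyB onlyAB nothing : Selector
everything _ _ = true
allButA    x _ = not x
allButAB   x y = not x ∧ not y
onlyA      x _ = x
onlyB      _ y = y
onlyAB     x y = x ∨ y
nothing    _ _ = false

pick-split : ∀ (σ : Selector) t x y → (x ≡ true → t ≡ true) → (y ≡ true → t ≡ true) → (x ≡ true → y ≡ false) →
  b2n (t ∧ σ x y) ≡ (if x then b2n (σ true false) else 0) + (if y then b2n (σ false true) else 0)
                    + b2n ((t ∧ allButAB x y) ∧ σ false false)
pick-split σ true  true  true  _   _   x⇒¬y with () ← x⇒¬y refl
pick-split σ true  true  false _   _   _ = sym (trans (+-identityʳ _) (+-identityʳ _))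
pick-split σ true  false true  _   _   _ = sym (+-identityʳ _)
pick-split σ true  false false _   _   _ = refl
pick-split σ false true  _     x⇒t _   _ with () ← x⇒t refl
pick-split σ false false true  _   y⇒t _ with () ← y⇒t refl
pick-split σ false false false _   _   _ = refl

-- The number of parallel edges σ takes when there are K parallel
-- edges besides a and b.
selected : ℕ → Selector → ℕ
selected K σ = b2n (σ true false) + b2n (σ false true) + (if σ false false then K else 0)

-- Lifting a cycle of the reduced graph adds the selected parallel edges,
-- and one edge more if it uses the edge created by the suppression
-- (flag c), which is replaced by a path of length two.  The same number
-- is the degree of the lifted cycle at v₁ and at v₂.
extra : ℕ → Selector → Bool → ℕ
extra K σ c = b2n c + selected K σ

-- A way to extend three cycles, with flags c₁ c₂ c₃ telling whether they
-- use the suppressed edge, over K + 2 parallel edges: together they take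
-- every parallel edge, each stays even at v₁ and v₂, and the total added
-- length is at most 44/27 of the K + 3 edges removed by the reduction.
record Plan (K : ℕ) (c₁ c₂ c₃ : Bool) : Set where
  field
    σ₁ σ₂ σ₃ : Selector
    covers   : ∀ x y → T (σ₁ x y ∨ σ₂ x y ∨ σ₃ x y)
    even₁    : 2 ∣ extra K σ₁ c₁
    even₂    : 2 ∣ extra K σ₂ c₂
    even₃    : 2 ∣ extra K σ₃ c₃
    short    : 27 * (extra K σ₁ c₁ + extra K σ₂ c₂ + extra K σ₃ c₃) ≤ 44 * (3 + K)

plan-swap₁₂ : ∀ {K c₁ c₂ c₃} → Plan K c₁ c₂ c₃ → Plan K c₂ c₁ c₃
plan-swap₁₂ {K} {c₁} {c₂} {c₃} P = record
  { σ₁ = σ₂ ; σ₂ = σ₁ ; σ₃ = σ₃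
  ; covers = λ x y → subst T (swap-∨ (σ₁ x y) (σ₂ x y) (σ₃ x y)) (covers x y)
  ; even₁ = even₂ ; even₂ = even₁ ; even₃ = even₃
  ; short = subst (λ t → 27 * (t + extra K σ₃ c₃) ≤ 44 * (3 + K))
                  (+-comm (extra K σ₁ c₁) (extra K σ₂ c₂)) short }
  where
  open Plan P
  swap-∨ : ∀ x y z → x ∨ y ∨ z ≡ y ∨ x ∨ z
  swap-∨ x y z = trans (sym (∨-assoc x y z)) (trans (cong (_∨ z) (∨-comm x y)) (∨-assoc y x z))

plan-swap₂₃ : ∀ {K c₁ c₂ c₃} → Plan K c₁ c₂ c₃ → Plan K c₁ c₃ c₂
plan-swap₂₃ {K} {c₁} {c₂} {c₃} P = record
  { σ₁ = σ₁ ; σ₂ = σ₃ ; σ₃ = σ₂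
  ; covers = λ x y → subst T (cong (σ₁ x y ∨_) (∨-comm (σ₂ x y) (σ₃ x y))) (covers x y)
  ; even₁ = even₁ ; even₂ = even₃ ; even₃ = even₂
  ; short = subst (λ t → 27 * t ≤ 44 * (3 + K))
                  (xy∙z≈xz∙y (extra K σ₁ c₁) (extra K σ₂ c₂) (extra K σ₃ c₃)) short }
  where open Plan P

parity : ∀ n → 2 ∣ n ⊎ 2 ∣ suc n
parity zero    = inj₁ (2 ∣0)
parity (suc n) with parity n
... | inj₁ 2∣n   = inj₂ (∣m∣n⇒∣m+n ∣-refl 2∣n)
... | inj₂ 2∣1+n = inj₁ 2∣1+n

fits-5 : ∀ K → 1 ≤ K → 27 * (5 + K) ≤ 44 * (3 + K)
fits-5 (suc K) _ = subst (27 * (5 + suc K) ≤_) (slack K) (m≤m+n _ _)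
  where
  slack : ∀ K → 27 * (5 + suc K) + (14 + 17 * K) ≡ 44 * (3 + suc K)
  slack = solve-∀

fits-4 : ∀ K → 1 ≤ K → 27 * (4 + K) ≤ 44 * (3 + K)
fits-4 K K≥1 = ≤-trans (*-monoʳ-≤ 27 (n≤1+n (4 + K))) (fits-5 K K≥1)

fits-6 : ∀ K → 2 ≤ K → 27 * (6 + K) ≤ 44 * (3 + K)
fits-6 (suc (suc K)) _       = subst (27 * (6 + suc (suc K)) ≤_) (slack K) (m≤m+n _ _)
  where
  slack : ∀ K → 27 * (6 + suc (suc K)) + (4 + 17 * K) ≡ 44 * (3 + suc (suc K))
  slack = solve-∀
fits-6 (suc zero)    (s≤s ())

-- In the plans below exactly one cycle takes the K unnamed parallel
-- edges, so the total extra length has the shape (a₁ + K) + a₂ + a₃.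
gathered : ∀ a₁ a₂ a₃ K → 27 * (a₁ + a₂ + a₃ + K) ≤ 44 * (3 + K) → 27 * (a₁ + K + a₂ + a₃) ≤ 44 * (3 + K)
gathered a₁ a₂ a₃ K = subst (λ t → 27 * t ≤ 44 * (3 + K)) (regroup a₁ a₂ a₃ K)
  where
  regroup : ∀ a₁ a₂ a₃ K → a₁ + a₂ + a₃ + K ≡ a₁ + K + a₂ + a₃
  regroup = solve-∀

-- Plans for the three flag patterns with c₁ ≥ c₂ ≥ c₃ and c₁ = true.
-- The first cycle takes the unnamed parallel edges; a or b is left out
-- of it when needed to make its degree at v₁, v₂ even.
plan-100 : ∀ K → 1 ≤ K → Plan K true false false
plan-100 K K≥1 with parity K
... | inj₁ 2∣K = record
  { σ₁ = allButA ; σ₂ = onlyAB ; σ₃ = nothing ; covers = λ { true _ → tt ; false _ → tt }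
  ; even₁ = ∣m∣n⇒∣m+n ∣-refl 2∣K ; even₂ = ∣-refl ; even₃ = 2 ∣0
  ; short = gathered 2 2 0 K (fits-4 K K≥1) }
... | inj₂ 2∣1+K = record
  { σ₁ = everything ; σ₂ = onlyAB ; σ₃ = nothing ; covers = λ _ _ → tt
  ; even₁ = ∣m∣n⇒∣m+n ∣-refl 2∣1+K ; even₂ = ∣-refl ; even₃ = 2 ∣0
  ; short = gathered 3 2 0 K (fits-5 K K≥1) }

plan-110 : ∀ K → 1 ≤ K → Plan K true true false
plan-110 K K≥1 with parity K
... | inj₁ 2∣K = record
  { σ₁ = allButA ; σ₂ = onlyA ; σ₃ = nothing ; covers = λ { true _ → tt ; false _ → tt }
  ; even₁ = ∣m∣n⇒∣m+n ∣-refl 2∣K ; even₂ = ∣-refl ; even₃ = 2 ∣0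
  ; short = gathered 2 2 0 K (fits-4 K K≥1) }
... | inj₂ 2∣1+K = record
  { σ₁ = everything ; σ₂ = onlyA ; σ₃ = nothing ; covers = λ _ _ → tt
  ; even₁ = ∣m∣n⇒∣m+n ∣-refl 2∣1+K ; even₂ = ∣-refl ; even₃ = 2 ∣0
  ; short = gathered 3 2 0 K (fits-5 K K≥1) }

plan-111 : ∀ K → 1 ≤ K → Plan K true true true
plan-111 K K≥1 with parity K
... | inj₁ 2∣K = record
  { σ₁ = allButA ; σ₂ = onlyA ; σ₃ = onlyB ; covers = λ { true _ → tt ; false _ → tt }
  ; even₁ = ∣m∣n⇒∣m+n ∣-refl 2∣K ; even₂ = ∣-refl ; even₃ = ∣-refl
  ; short = gathered 2 2 2 K (fits-6 K (∣⇒≤ {{>-nonZero K≥1}} 2∣K)) }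
... | inj₂ 2∣1+K = record
  { σ₁ = allButAB ; σ₂ = onlyA ; σ₃ = onlyB
  ; covers = λ { true _ → tt ; false true → tt ; false false → tt }
  ; even₁ = 2∣1+K ; even₂ = ∣-refl ; even₃ = ∣-refl
  ; short = gathered 1 2 2 K (fits-5 K K≥1) }

plan : ∀ K → 1 ≤ K → ∀ c₁ c₂ c₃ → T (c₁ ∨ c₂ ∨ c₃) → Plan K c₁ c₂ c₃
plan K K≥1 true  true  true  _ = plan-111 K K≥1
plan K K≥1 true  true  false _ = plan-110 K K≥1
plan K K≥1 true  false true  _ = plan-swap₂₃ (plan-110 K K≥1)
plan K K≥1 true  false false _ = plan-100 K K≥1
plan K K≥1 false true  true  _ = plan-swap₁₂ (plan-swap₂₃ (plan-110 K K≥1))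
plan K K≥1 false true  false _ = plan-swap₁₂ (plan-100 K K≥1)
plan K K≥1 false false true  _ = plan-swap₂₃ (plan-swap₁₂ (plan-100 K K≥1))
plan K K≥1 false false false ()

squeeze : ∀ x y z → x + y + z ≡ 2 → 1 ≤ x → 1 ≤ y → x ≡ 1 × y ≡ 1 × z ≡ 0
squeeze (suc x) (suc y) z eq _ _ =
  cong suc (m+n≡0⇒m≡0 x (m+n≡0⇒m≡0 (x + y) rest≡0)) ,
  cong suc (m+n≡0⇒n≡0 x (m+n≡0⇒m≡0 (x + y) rest≡0)) ,
  m+n≡0⇒n≡0 (x + y) rest≡0
  where
  shift : ∀ x y z → suc x + suc y + z ≡ 2 + (x + y + z)
  shift = solve-∀
  rest≡0 : x + y + z ≡ 0
  rest≡0 = +-cancelˡ-≡ 2 _ _ (trans (sym (shift x y z)) eq)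

-- Write par for the k parallel edges
-- joining v₁ and v₂, Hc for the contracted graph with merged vertex w,
-- e₁ e₂ for the two edges of Hc at w and H for the suppressed graph.
module Reduction
  {n m} (G : Graph (suc (suc n)) m) (v₁ v₂ : Fin (suc (suc n))) (k : ℕ) (v₁≢v₂ : v₁ ≢ v₂)
  (mult : multiplicity G v₁ v₂ ≡ k) (deg₁ : degree G v₁ ≡ suc k) (deg₂ : degree G v₂ ≡ suc k)
  (e₁ e₂ : Fin (length (kept m (λ e → not (joins G v₁ v₂ e))))) (e₁≢e₂ : e₁ ≢ e₂)
  (I₁ : Incident (contractBetween G v₁ v₂ v₁≢v₂) (merge v₁ v₂ v₁≢v₂ v₁) e₁)
  (I₂ : Incident (contractBetween G v₁ v₂ v₁≢v₂) (merge v₁ v₂ v₁≢v₂ v₁) e₂)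
  (u≢w : otherEnd (contractBetween G v₁ v₂ v₁≢v₂) (merge v₁ v₂ v₁≢v₂ v₁) e₁
         ≢ merge v₁ v₂ v₁≢v₂ v₁)
  where

  par : Fin m → Bool
  par = joins G v₁ v₂

  module K₁ = Kept m (λ e → not (par e))
  m₁ : ℕ
  m₁ = length (kept m (λ e → not (par e)))

  Hc : Graph (suc n) m₁
  Hc = contractBetween G v₁ v₂ v₁≢v₂

  mg : Fin (suc (suc n)) → Fin (suc n)
  mg = merge v₁ v₂ v₁≢v₂

  w : Fin (suc n)
  w = mg v₁

  module K₂ = Kept m₁ (λ i → not (i == e₁) ∧ not (i == e₂))
  m₂ : ℕ
  m₂ = length (kept m₁ (λ i → not (i == e₁) ∧ not (i == e₂)))

  H : Graph n (suc m₂)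
  H = suppress Hc w e₁ e₂ u≢w

  -- the deletion of w in the suppression, and the vertex of H that a
  -- vertex of G other than v₁, v₂ becomes
  remove-w : Fin (suc n) → Fin n
  remove-w = removeV w (punchOut {i = w} {j = otherEnd Hc w e₁} (u≢w ∘ sym))

  h : Fin (suc (suc n)) → Fin n
  h x = remove-w (mg x)

  -- the edges of G on the suppressed path, and those that survive in H
  f₁ f₂ : Fin m
  f₁ = K₁.ι e₁
  f₂ = K₁.ι e₂

  rest : Fin m₂ → Fin m
  rest j = K₁.ι (K₂.ι j)

  sum-edges : ∀ (F : Fin m → ℕ) → sumFin m F ≡
    sumFin m (λ e → if par e then F e else 0) + (F f₁ + F f₂ + sumFin m₂ (F ∘ rest))
  sum-edges F = begin
    sumFin m F
      ≡⟨ sumFin-split m par F ⟩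
    Par + sumFin m (λ e → if par e then 0 else F e)
      ≡⟨ cong (Par +_) (trans (sumFin-cong m flip) (K₁.sum-filtered F)) ⟩
    Par + sumFin m₁ (F ∘ K₁.ι)
      ≡⟨ cong (Par +_) (sum-path (F ∘ K₁.ι)) ⟩
    Par + (F f₁ + F f₂ + sumFin m₂ (F ∘ rest)) ∎
    where
    open ≡-Reasoning
    Par : ℕ
    Par = sumFin m (λ e → if par e then F e else 0)
    flip : ∀ e → (if par e then 0 else F e) ≡ (if not (par e) then F e else 0)
    flip e with par e
    ... | true  = refl
    ... | false = refl
    path-only : ∀ (g : Fin m₁ → ℕ) i → (if not (i == e₁) ∧ not (i == e₂) then 0 else g i)
                                     ≡ (if i == e₁ then g i else 0) + (if i == e₂ then g i else 0)
    path-only g i with i == e₁ in is₁ | i == e₂ in is₂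
    ... | true  | true  = ⊥-elim (e₁≢e₂ (trans (sym (==-sound is₁)) (==-sound is₂)))
    ... | true  | false = sym (+-identityʳ _)
    ... | false | true  = refl
    ... | false | false = refl
    sum-path : ∀ (g : Fin m₁ → ℕ) → sumFin m₁ g ≡ g e₁ + g e₂ + sumFin m₂ (g ∘ K₂.ι)
    sum-path g = trans (K₂.sum-split g)
      (trans (cong (sumFin m₂ (g ∘ K₂.ι) +_)
                   (trans (sumFin-cong m₁ (path-only g))
                   (trans (sumFin-+ m₁ _ _) (cong₂ _+_ (sumFin-indicator m₁ g e₁) (sumFin-indicator m₁ g e₂)))))
             (+-comm (sumFin m₂ (g ∘ K₂.ι)) (g e₁ + g e₂)))

  sum-parallel : ∀ (F : Fin m → ℕ) → (∀ e → par e ≡ true → F e ≡ 1) → sumFin m (λ e → if par e then F e else 0) ≡ k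
  sum-parallel F F≡1 = trans (sumFin-cong m one) mult
    where
    one : ∀ e → (if par e then F e else 0) ≡ b2n (par e)
    one e with par e in pe
    ... | true  = F≡1 e pe
    ... | false = refl

  edge-count : m ≡ k + (2 + m₂)
  edge-count = trans (sym (sumFin-const m)) (trans (sum-edges (λ _ → 1))
    (cong₂ _+_ (sum-parallel (λ _ → 1) (λ _ _ → refl)) (cong (2 +_) (sumFin-const m₂))))

  Out : Fin (suc (suc n)) → Set
  Out x = x ≢ v₁ × x ≢ v₂

  hits : Fin (suc (suc n)) → ℕ
  hits x = b2n (x == v₁) + b2n (x == v₂)

  hits-end : ∀ x → x ≡ v₁ ⊎ x ≡ v₂ → hits x ≡ 1
  hits-end _ (inj₁ refl) = cong₂ _+_ (cong b2n (==-refl v₁)) (cong b2n (==-false v₁≢v₂))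
  hits-end _ (inj₂ refl) = cong₂ _+_ (cong b2n (==-false (v₁≢v₂ ∘ sym))) (cong b2n (==-refl v₂))

  hits-zero : ∀ x → hits x ≡ 0 → Out x
  hits-zero x none = (λ x≡v₁ → one≢zero (inj₁ x≡v₁)) , (λ x≡v₂ → one≢zero (inj₂ x≡v₂))
    where
    one≢zero : x ≡ v₁ ⊎ x ≡ v₂ → ⊥
    one≢zero end with () ← trans (sym (hits-end x end)) none

  end≢out : ∀ {x v} → x ≡ v₁ ⊎ x ≡ v₂ → Out v → x ≢ v
  end≢out (inj₁ refl) (v≢v₁ , _) = v≢v₁ ∘ sym
  end≢out (inj₂ refl) (_ , v≢v₂) = v≢v₂ ∘ sym

  ends-hits : ∀ e → incidence G v₁ e + incidence G v₂ e ≡ hits (proj₁ (G e)) + hits (proj₂ (G e))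
  ends-hits e = interchange (b2n (proj₁ (G e) == v₁)) (b2n (proj₂ (G e) == v₁))
                            (b2n (proj₁ (G e) == v₂)) (b2n (proj₂ (G e) == v₂))

  merged : ∀ x → mg x ≡ w → x ≡ v₁ ⊎ x ≡ v₂
  merged = merge-fibre v₁ v₂ v₁≢v₂

  out-not-merged : ∀ {x} → Out x → mg x ≢ w
  out-not-merged {x} (x≢v₁ , x≢v₂) at with merged x at
  ... | inj₁ x≡v₁ = x≢v₁ x≡v₁
  ... | inj₂ x≡v₂ = x≢v₂ x≡v₂

  parallel-at-v₁ : ∀ e → par e ≡ true → incidence G v₁ e ≡ 1
  parallel-at-v₁ e pe = trans (incidence-joins G v₁ v₂ e v₁ pe)
    (cong₂ _+_ (cong b2n (==-refl v₁)) (cong b2n (==-false (v₁≢v₂ ∘ sym))))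

  parallel-at-v₂ : ∀ e → par e ≡ true → incidence G v₂ e ≡ 1
  parallel-at-v₂ e pe = trans (incidence-joins G v₁ v₂ e v₂ pe)
    (cong₂ _+_ (cong b2n (==-false v₁≢v₂)) (cong b2n (==-refl v₂)))

  parallel-avoids : ∀ {v} → Out v → ∀ e → par e ≡ true → incidence G v e ≡ 0
  parallel-avoids {v} (v≢v₁ , v≢v₂) e pe = trans (incidence-joins G v₁ v₂ e v pe)
    (cong₂ _+_ (cong b2n (==-false (v≢v₁ ∘ sym))) (cong b2n (==-false (v≢v₂ ∘ sym))))

  one-more : ∀ v → (∀ e → par e ≡ true → incidence G v e ≡ 1) → degree G v ≡ suc k →
    incidence G v f₁ + incidence G v f₂ + sumFin m₂ (incidence G v ∘ rest) ≡ 1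
  one-more v par≡1 deg = +-cancelˡ-≡ k _ _ (begin
    k + Beyond                                               ≡⟨ cong (_+ Beyond) (sum-parallel _ par≡1) ⟨
    sumFin m (λ e → if par e then incidence G v e else 0) + Beyond ≡⟨ sum-edges (incidence G v) ⟨
    degree G v                                               ≡⟨ deg ⟩
    suc k                                                    ≡⟨ +-comm 1 k ⟩
    k + 1                                                    ∎)
    where
    open ≡-Reasoning
    Beyond : ℕ
    Beyond = incidence G v f₁ + incidence G v f₂ + sumFin m₂ (incidence G v ∘ rest)

  path-touches : ∀ i → Incident Hc w i → 1 ≤ incidence G v₁ (K₁.ι i) + incidence G v₂ (K₁.ι i)
  path-touches i (inj₁ at) = subst (1 ≤_) (sym (ends-hits (K₁.ι i)))
    (subst (λ t → 1 ≤ t + hits (proj₂ (G (K₁.ι i)))) (sym (hits-end (proj₁ (G (K₁.ι i))) (merged (proj₁ (G (K₁.ι i))) at)))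
           (m≤m+n 1 (hits (proj₂ (G (K₁.ι i))))))
  path-touches i (inj₂ at) = subst (1 ≤_) (sym (ends-hits (K₁.ι i)))
    (subst (λ t → 1 ≤ hits (proj₁ (G (K₁.ι i))) + t) (sym (hits-end (proj₂ (G (K₁.ι i))) (merged (proj₂ (G (K₁.ι i))) at)))
           (m≤n+m 1 (hits (proj₁ (G (K₁.ι i))))))

  path-analysis :
    incidence G v₁ f₁ + incidence G v₂ f₁ ≡ 1 × incidence G v₁ f₂ + incidence G v₂ f₂ ≡ 1 ×
    sumFin m₂ (incidence G v₁ ∘ rest) + sumFin m₂ (incidence G v₂ ∘ rest) ≡ 0
  path-analysis = squeeze _ _ _
    (trans (regroup (incidence G v₁ f₁) (incidence G v₁ f₂) (sumFin m₂ (incidence G v₁ ∘ rest))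
                    (incidence G v₂ f₁) (incidence G v₂ f₂) (sumFin m₂ (incidence G v₂ ∘ rest)))
           (cong₂ _+_ (one-more v₁ parallel-at-v₁ deg₁) (one-more v₂ parallel-at-v₂ deg₂)))
    (path-touches e₁ I₁) (path-touches e₂ I₂)
    where
    regroup : ∀ a₁ a₂ r b₁ b₂ s → a₁ + b₁ + (a₂ + b₂) + (r + s) ≡ (a₁ + a₂ + r) + (b₁ + b₂ + s)
    regroup = solve-∀

  rest-avoids-v₁ : ∀ j → incidence G v₁ (rest j) ≡ 0
  rest-avoids-v₁ = sumFin-zero⁻ m₂ _ (m+n≡0⇒m≡0 _ (proj₂ (proj₂ path-analysis)))

  rest-avoids-v₂ : ∀ j → incidence G v₂ (rest j) ≡ 0
  rest-avoids-v₂ = sumFin-zero⁻ m₂ _ (m+n≡0⇒n≡0 _ (proj₂ (proj₂ path-analysis)))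

  path-at : ∀ v → (∀ e → par e ≡ true → incidence G v e ≡ 1) → degree G v ≡ suc k →
    (∀ j → incidence G v (rest j) ≡ 0) → incidence G v f₁ + incidence G v f₂ ≡ 1
  path-at v par≡1 deg avoids = trans (sym (+-identityʳ _))
    (trans (cong (incidence G v f₁ + incidence G v f₂ +_) (sym (sumFin-zero m₂ _ avoids)))
           (one-more v par≡1 deg))

  rest-ends-out : ∀ j → Out (proj₁ (G (rest j))) × Out (proj₂ (G (rest j)))
  rest-ends-out j = hits-zero _ (m+n≡0⇒m≡0 (hits (proj₁ (G (rest j)))) none) ,
                    hits-zero _ (m+n≡0⇒n≡0 (hits (proj₁ (G (rest j)))) none)
    where
    none : hits (proj₁ (G (rest j))) + hits (proj₂ (G (rest j))) ≡ 0
    none = trans (sym (ends-hits (rest j))) (cong₂ _+_ (rest-avoids-v₁ j) (rest-avoids-v₂ j))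

  record PathEdge (i : Fin m₁) : Set where
    field
      far     : Fin (suc (suc n))
      far-out : Out far
      far-end : otherEnd Hc w i ≡ mg far
      meets   : ∀ v → Out v → incidence G v (K₁.ι i) ≡ b2n (far == v)

  path-edge : ∀ i → Incident Hc w i → incidence G v₁ (K₁.ι i) + incidence G v₂ (K₁.ι i) ≡ 1 → PathEdge i
  path-edge i (inj₁ at) once = record
    { far     = y
    ; far-out = hits-zero y (+-cancelˡ-≡ 1 (hits y) 0
                  (trans (cong (_+ hits y) (sym (hits-end x (merged x at)))) (trans (sym (ends-hits (K₁.ι i))) once)))
    ; far-end = otherEnd-of-fst Hc w i at
    ; meets   = λ v v-out → cong (λ t → b2n t + b2n (y == v)) (==-false (end≢out (merged x at) v-out))
    }
    where
    x y : Fin (suc (suc n))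
    x = proj₁ (G (K₁.ι i))
    y = proj₂ (G (K₁.ι i))
  path-edge i (inj₂ at) once = record
    { far     = x
    ; far-out = x-out
    ; far-end = otherEnd-of-snd Hc w i (out-not-merged x-out)
    ; meets   = λ v v-out → trans (cong (λ t → b2n (x == v) + b2n t) (==-false (end≢out (merged y at) v-out)))
                                 (+-identityʳ _)
    }
    where
    x y : Fin (suc (suc n))
    x = proj₁ (G (K₁.ι i))
    y = proj₂ (G (K₁.ι i))
    x-out : Out x
    x-out = hits-zero x (+-cancelʳ-≡ 1 (hits x) 0
              (trans (cong (hits x +_) (sym (hits-end y (merged y at)))) (trans (sym (ends-hits (K₁.ι i))) once)))

  path-edge₁ : PathEdge e₁
  path-edge₁ = path-edge e₁ I₁ (proj₁ path-analysis)

  path-edge₂ : PathEdge e₂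
  path-edge₂ = path-edge e₂ I₂ (proj₁ (proj₂ path-analysis))

  h-injective : ∀ {x v} → Out x → Out v → h x ≡ h v → x ≡ v
  h-injective x-out v-out eq =
    punchOut-like-injective (merge-agrees v₁ v₂ v₁≢v₂) (proj₂ x-out) (proj₂ v-out)
      (punchOut-like-injective (removeV-agrees w _) (out-not-merged x-out) (out-not-merged v-out) eq)

  h-reflects : ∀ {x v} → Out x → Out v → (h x == h v) ≡ (x == v)
  h-reflects {x} {v} x-out v-out with x ≟ v
  ... | yes refl = ==-refl (h x)
  ... | no  x≢v  = ==-false (x≢v ∘ h-injective x-out v-out)

  H-new-edge : ∀ {v} → Out v → incidence H (h v) zero ≡ incidence G v f₁ + incidence G v f₂
  H-new-edge {v} v-out = cong₂ _+_ (far-meets path-edge₁) (far-meets path-edge₂)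
    where
    far-meets : ∀ {i} (P : PathEdge i) → b2n (remove-w (otherEnd Hc w i) == h v) ≡ incidence G v (K₁.ι i)
    far-meets P = trans (cong (λ t → b2n (remove-w t == h v)) (PathEdge.far-end P))
      (trans (cong b2n (h-reflects (PathEdge.far-out P) v-out)) (sym (PathEdge.meets P v v-out)))

  H-rest : ∀ {v} → Out v → ∀ j → incidence H (h v) (suc j) ≡ incidence G v (rest j)
  H-rest v-out j = cong₂ _+_ (cong b2n (h-reflects (proj₁ (rest-ends-out j)) v-out))
                             (cong b2n (h-reflects (proj₂ (rest-ends-out j)) v-out))

  module Lifting (a b : Fin m) (a≢b : a ≢ b) (par-a : par a ≡ true) (par-b : par b ≡ true) where

    pick : Selector → EdgeSet m
    pick σ e = par e ∧ σ (e == a) (e == b)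

    K : ℕ
    K = size (pick allButAB)

    -- Both edges of the suppressed path take the flag of the new edge.
    unsuppress : EdgeSet (suc m₂) → EdgeSet m₁
    unsuppress C i = if (i == e₁) ∨ (i == e₂) then C zero else K₂.extend (C ∘ suc) i

    lift : EdgeSet (suc m₂) → Selector → EdgeSet m
    lift C σ e = if par e then σ (e == a) (e == b) else K₁.extend (unsuppress C) e

    lift-parallel : ∀ C σ e → par e ≡ true → lift C σ e ≡ σ (e == a) (e == b)
    lift-parallel C σ e pe = cong (λ t → if t then σ (e == a) (e == b) else K₁.extend (unsuppress C) e) pe

    lift-ι : ∀ C σ i → lift C σ (K₁.ι i) ≡ unsuppress C i
    lift-ι C σ i = trans (cong (λ t → if t then σ (K₁.ι i == a) (K₁.ι i == b) else K₁.extend (unsuppress C) (K₁.ι i))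
                               (not-true (K₁.ι-kept i)))
                         (K₁.extend-ι (unsuppress C) i)
      where
      not-true : ∀ {t} → not t ≡ true → t ≡ false
      not-true {false} _ = refl

    unsuppress-e₁ : ∀ C → unsuppress C e₁ ≡ C zero
    unsuppress-e₁ C = cong (λ t → if t ∨ (e₁ == e₂) then C zero else K₂.extend (C ∘ suc) e₁) (==-refl e₁)

    unsuppress-e₂ : ∀ C → unsuppress C e₂ ≡ C zero
    unsuppress-e₂ C = cong₂ (λ t u → if t ∨ u then C zero else K₂.extend (C ∘ suc) e₂)
                            (==-false (e₁≢e₂ ∘ sym)) (==-refl e₂)

    unsuppress-ι : ∀ C j → unsuppress C (K₂.ι j) ≡ C (suc j)
    unsuppress-ι C j = trans (cong₂ (λ t u → if t ∨ u then C zero else K₂.extend (C ∘ suc) (K₂.ι j))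
                                    (proj₁ avoids-path) (proj₂ avoids-path))
                             (K₂.extend-ι (C ∘ suc) j)
      where
      neither : ∀ s t → not s ∧ not t ≡ true → s ≡ false × t ≡ false
      neither false false _ = refl , refl
      avoids-path : (K₂.ι j == e₁) ≡ false × (K₂.ι j == e₂) ≡ false
      avoids-path = neither (K₂.ι j == e₁) (K₂.ι j == e₂) (K₂.ι-kept j)

    lift-f₁ : ∀ C σ → lift C σ f₁ ≡ C zero
    lift-f₁ C σ = trans (lift-ι C σ e₁) (unsuppress-e₁ C)

    lift-f₂ : ∀ C σ → lift C σ f₂ ≡ C zero
    lift-f₂ C σ = trans (lift-ι C σ e₂) (unsuppress-e₂ C)

    lift-rest : ∀ C σ j → lift C σ (rest j) ≡ C (suc j)
    lift-rest C σ j = trans (lift-ι C σ (K₂.ι j)) (unsuppress-ι C j)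

    origin : ∀ e → par e ≡ false → Σ[ t ∈ Fin (suc m₂) ] (∀ C σ → lift C σ e ≡ C t)
    origin e not-par = classify (i == e₁) refl (i == e₂) refl
      where
      kept₁ : not (par e) ≡ true
      kept₁ = cong not not-par
      i : Fin m₁
      i = K₁.position e kept₁
      at-i : ∀ C σ → lift C σ e ≡ unsuppress C i
      at-i C σ = trans (cong (lift C σ) (sym (K₁.ι-position e kept₁))) (lift-ι C σ i)
      classify : ∀ s → (i == e₁) ≡ s → ∀ t → (i == e₂) ≡ t → Σ[ t ∈ Fin (suc m₂) ] (∀ C σ → lift C σ e ≡ C t)
      classify true  is₁ _     _   = zero , λ C σ → trans (at-i C σ) (trans (cong (unsuppress C) (==-sound is₁)) (unsuppress-e₁ C))
      classify false _   true  is₂ = zero , λ C σ → trans (at-i C σ) (trans (cong (unsuppress C) (==-sound is₂)) (unsuppress-e₂ C))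
      classify false is₁ false is₂ = suc j , λ C σ →
        trans (at-i C σ) (trans (cong (unsuppress C) (sym (K₂.ι-position i kept₂))) (unsuppress-ι C j))
        where
        kept₂ : not (i == e₁) ∧ not (i == e₂) ≡ true
        kept₂ = cong₂ (λ s t → not s ∧ not t) is₁ is₂
        j : Fin m₂
        j = K₂.position i kept₂

    weight-lift : ∀ C σ (g : Fin m → ℕ) → weight (lift C σ) g ≡
      weight (pick σ) g + ((if C zero then g f₁ + g f₂ else 0) + sumFin m₂ (λ j → if C (suc j) then g (rest j) else 0))
    weight-lift C σ g = trans (sum-edges F)
      (cong₂ _+_ (sumFin-cong m parallel-part) (cong₂ _+_ path-part (sumFin-cong m₂ rest-part)))
      where
      F : Fin m → ℕ
      F e = if lift C σ e then g e else 0
      parallel-part : ∀ e → (if par e then F e else 0) ≡ (if pick σ e then g e else 0)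
      parallel-part e = by-cases (par e) refl
        where
        by-cases : ∀ t → par e ≡ t → (if t then F e else 0) ≡ (if t ∧ σ (e == a) (e == b) then g e else 0)
        by-cases true  pe = cong (λ t → if t then g e else 0) (lift-parallel C σ e pe)
        by-cases false _  = refl
      path-part : F f₁ + F f₂ ≡ (if C zero then g f₁ + g f₂ else 0)
      path-part = trans (cong₂ _+_ (cong (λ t → if t then g f₁ else 0) (lift-f₁ C σ))
                                   (cong (λ t → if t then g f₂ else 0) (lift-f₂ C σ)))
                        (if-+ (C zero) (g f₁) (g f₂))
      rest-part : ∀ j → F (rest j) ≡ (if C (suc j) then g (rest j) else 0)
      rest-part j = cong (λ t → if t then g (rest j) else 0) (lift-rest C σ j)

    pick-size : ∀ σ → size (pick σ) ≡ selected K σ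
    pick-size σ = begin
      sumFin m (λ e → b2n (pick σ e))
        ≡⟨ sumFin-cong m (λ e → pick-split σ (par e) (e == a) (e == b) (at-par a par-a) (at-par b par-b) (a-not-b e)) ⟩
      sumFin m (λ e → Ta e + Tb e + Tk e)
        ≡⟨ trans (sumFin-+ m _ Tk) (cong (_+ sumFin m Tk) (sumFin-+ m Ta Tb)) ⟩
      sumFin m Ta + sumFin m Tb + sumFin m Tk
        ≡⟨ cong₂ _+_ (cong₂ _+_ (sumFin-indicator m (λ _ → b2n (σ true false)) a)
                                (sumFin-indicator m (λ _ → b2n (σ false true)) b))
                     (count-∧ m (pick allButAB) (σ false false)) ⟩
      selected K σ ∎
      where
      open ≡-Reasoning
      Ta Tb Tk : Fin m → ℕ
      Ta e = if e == a then b2n (σ true false) else 0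
      Tb e = if e == b then b2n (σ false true) else 0
      Tk e = b2n (pick allButAB e ∧ σ false false)
      at-par : ∀ c → par c ≡ true → ∀ {e} → (e == c) ≡ true → par e ≡ true
      at-par c par-c e≡c = subst (λ x → par x ≡ true) (sym (==-sound e≡c)) par-c
      a-not-b : ∀ e → (e == a) ≡ true → (e == b) ≡ false
      a-not-b e e≡a = ==-false (λ e≡b → a≢b (trans (sym (==-sound e≡a)) e≡b))

    parallel-count : 2 + K ≡ k
    parallel-count = trans (sym (pick-size everything))
                           (trans (sumFin-cong m (λ e → cong b2n (∧-identityʳ (par e)))) mult)

    weight-pick-ones : ∀ σ (g : Fin m → ℕ) → (∀ e → par e ≡ true → g e ≡ 1) → weight (pick σ) g ≡ size (pick σ)
    weight-pick-ones σ g g≡1 = sumFin-cong m term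
      where
      term : ∀ e → (if pick σ e then g e else 0) ≡ b2n (pick σ e)
      term e = by-cases (par e) refl
        where
        by-cases : ∀ t → par e ≡ t → (if t ∧ σ (e == a) (e == b) then g e else 0) ≡ b2n (t ∧ σ (e == a) (e == b))
        by-cases true  pe = trans (cong (λ x → if σ (e == a) (e == b) then x else 0) (g≡1 e pe)) (if-one _)
        by-cases false _  = refl

    weight-pick-avoids : ∀ σ (g : Fin m → ℕ) → (∀ e → par e ≡ true → g e ≡ 0) → weight (pick σ) g ≡ 0
    weight-pick-avoids σ g g≡0 = sumFin-zero m _ term
      where
      term : ∀ e → (if pick σ e then g e else 0) ≡ 0
      term e = by-cases (par e) refl
        where
        by-cases : ∀ t → par e ≡ t → (if t ∧ σ (e == a) (e == b) then g e else 0) ≡ 0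
        by-cases true  pe = if-zero (σ (e == a) (e == b)) (g≡0 e pe)
        by-cases false _  = refl

    lift-degree-end : ∀ C σ v → (∀ e → par e ≡ true → incidence G v e ≡ 1) →
      incidence G v f₁ + incidence G v f₂ ≡ 1 → (∀ j → incidence G v (rest j) ≡ 0) →
      weight (lift C σ) (incidence G v) ≡ extra K σ (C zero)
    lift-degree-end C σ v par≡1 path≡1 rest≡0 = begin
      weight (lift C σ) (incidence G v)
        ≡⟨ weight-lift C σ (incidence G v) ⟩
      weight (pick σ) (incidence G v) + ((if C zero then incidence G v f₁ + incidence G v f₂ else 0)
        + sumFin m₂ (λ j → if C (suc j) then incidence G v (rest j) else 0))
        ≡⟨ cong₂ _+_ (trans (weight-pick-ones σ (incidence G v) par≡1) (pick-size σ))
                     (cong₂ _+_ (trans (cong (λ x → if C zero then x else 0) path≡1) (if-one (C zero)))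
                                (sumFin-zero m₂ _ (λ j → if-zero (C (suc j)) (rest≡0 j)))) ⟩
      selected K σ + (b2n (C zero) + 0)
        ≡⟨ trans (cong (selected K σ +_) (+-identityʳ _)) (+-comm (selected K σ) (b2n (C zero))) ⟩
      extra K σ (C zero) ∎
      where open ≡-Reasoning

    lift-degree-out : ∀ C σ v → Out v → weight (lift C σ) (incidence G v) ≡ weight C (incidence H (h v))
    lift-degree-out C σ v v-out = trans (weight-lift C σ (incidence G v))
      (cong₂ _+_ (weight-pick-avoids σ (incidence G v) (parallel-avoids v-out))
                 (cong₂ _+_ (cong (λ x → if C zero then x else 0) (sym (H-new-edge v-out)))
                            (sumFin-cong m₂ (λ j → cong (λ x → if C (suc j) then x else 0) (sym (H-rest v-out j))))))

    lift-cycle : ∀ C σ → IsCycle H C → 2 ∣ extra K σ (C zero) → IsCycle G (lift C σ)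
    lift-cycle C σ cycle even v = by-cases (v ≟ v₁) (v ≟ v₂)
      where
      Even-at : Fin (suc (suc n)) → Set
      Even-at u = 2 ∣ weight (lift C σ) (incidence G u)
      by-cases : Dec (v ≡ v₁) → Dec (v ≡ v₂) → Even-at v
      by-cases (yes v≡v₁) _ = subst Even-at (sym v≡v₁) (subst (2 ∣_) (sym
        (lift-degree-end C σ v₁ parallel-at-v₁ (path-at v₁ parallel-at-v₁ deg₁ rest-avoids-v₁) rest-avoids-v₁)) even)
      by-cases (no _) (yes v≡v₂) = subst Even-at (sym v≡v₂) (subst (2 ∣_) (sym
        (lift-degree-end C σ v₂ parallel-at-v₂ (path-at v₂ parallel-at-v₂ deg₂ rest-avoids-v₂) rest-avoids-v₂)) even)
      by-cases (no v≢v₁) (no v≢v₂) = subst (2 ∣_) (sym (lift-degree-out C σ v (v≢v₁ , v≢v₂))) (cycle (h v))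

    lift-size : ∀ C σ → size (lift C σ) ≡ size C + extra K σ (C zero)
    lift-size C σ = begin
      size (lift C σ)
        ≡⟨ size≡weight (lift C σ) ⟩
      weight (lift C σ) (λ _ → 1)
        ≡⟨ weight-lift C σ (λ _ → 1) ⟩
      weight (pick σ) (λ _ → 1) + ((if C zero then 2 else 0) + sumFin m₂ (λ j → if C (suc j) then 1 else 0))
        ≡⟨ cong₂ _+_ (trans (weight-pick-ones σ (λ _ → 1) (λ _ _ → refl)) (pick-size σ))
                     (cong₂ _+_ (if-two (C zero)) (sumFin-cong m₂ (λ j → if-one (C (suc j))))) ⟩
      selected K σ + ((b2n (C zero) + b2n (C zero)) + sumFin m₂ (λ j → b2n (C (suc j))))
        ≡⟨ regroup (selected K σ) (b2n (C zero)) _ ⟩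
      size C + extra K σ (C zero) ∎
      where
      open ≡-Reasoning
      regroup : ∀ s c r → s + ((c + c) + r) ≡ (c + r) + (c + s)
      regroup = solve-∀

    lift-covers : ∀ C₁ C₂ C₃ σ₁ σ₂ σ₃ → (∀ t → T (C₁ t ∨ C₂ t ∨ C₃ t)) →
      (∀ x y → T (σ₁ x y ∨ σ₂ x y ∨ σ₃ x y)) → ∀ e → T (lift C₁ σ₁ e ∨ lift C₂ σ₂ e ∨ lift C₃ σ₃ e)
    lift-covers C₁ C₂ C₃ σ₁ σ₂ σ₃ Cs-cover σs-cover e = by-cases (par e) refl
      where
      by-cases : ∀ t → par e ≡ t → T (lift C₁ σ₁ e ∨ lift C₂ σ₂ e ∨ lift C₃ σ₃ e)
      by-cases true  pe = subst T (sym (cong₂ _∨_ (lift-parallel C₁ σ₁ e pe)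
                                        (cong₂ _∨_ (lift-parallel C₂ σ₂ e pe) (lift-parallel C₃ σ₃ e pe))))
                                  (σs-cover _ _)
      by-cases false pe = subst T (sym (cong₂ _∨_ (at-t C₁ σ₁) (cong₂ _∨_ (at-t C₂ σ₂) (at-t C₃ σ₃)))) (Cs-cover t)
        where
        t : Fin (suc m₂)
        t = proj₁ (origin e pe)
        at-t : ∀ C σ → lift C σ e ≡ C t
        at-t = proj₂ (origin e pe)

    removed-edges : m ∸ k ∸ 1 ≡ suc m₂
    removed-edges = trans (cong (λ t → t ∸ k ∸ 1) edge-count) (cong (_∸ 1) (m+n∸m≡n k (2 + m₂)))

    -- The lengths: the cover of H has length ≤ 44/27 (m − k − 1), the
    -- plan adds at most 44/27 (k + 1), and m = (m − k − 1) + (k + 1).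
    lift-cover : ∀ C₁ C₂ C₃ → IsCycle H C₁ → IsCycle H C₂ → IsCycle H C₃ → (∀ t → T (C₁ t ∨ C₂ t ∨ C₃ t)) →
      27 * (size C₁ + size C₂ + size C₃) ≤ 44 * (m ∸ k ∸ 1) →
      Plan K (C₁ zero) (C₂ zero) (C₃ zero) → HasCover3 G (44 * m)
    lift-cover C₁ C₂ C₃ cycle₁ cycle₂ cycle₃ covered short-H P =
      lift C₁ σ₁ , lift C₂ σ₂ , lift C₃ σ₃ ,
      lift-cycle C₁ σ₁ cycle₁ even₁ , lift-cycle C₂ σ₂ cycle₂ even₂ , lift-cycle C₃ σ₃ cycle₃ even₃ ,
      lift-covers C₁ C₂ C₃ σ₁ σ₂ σ₃ covered covers ,
      (begin
        27 * (size (lift C₁ σ₁) + size (lift C₂ σ₂) + size (lift C₃ σ₃))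
          ≡⟨ cong (27 *_) (cong₂ _+_ (cong₂ _+_ (lift-size C₁ σ₁) (lift-size C₂ σ₂)) (lift-size C₃ σ₃)) ⟩
        27 * ((size C₁ + x₁) + (size C₂ + x₂) + (size C₃ + x₃))
          ≡⟨ separate (size C₁) (size C₂) (size C₃) x₁ x₂ x₃ ⟩
        27 * (size C₁ + size C₂ + size C₃) + 27 * (x₁ + x₂ + x₃)
          ≤⟨ +-mono-≤ short-H short ⟩
        44 * (m ∸ k ∸ 1) + 44 * (3 + K)
          ≡⟨ cong (λ t → 44 * t + 44 * (3 + K)) removed-edges ⟩
        44 * suc m₂ + 44 * (3 + K)
          ≡⟨ recombine m₂ K ⟩
        44 * ((2 + K) + (2 + m₂))
          ≡⟨ cong (λ t → 44 * (t + (2 + m₂))) parallel-count ⟩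
        44 * (k + (2 + m₂))
          ≡⟨ cong (44 *_) edge-count ⟨
        44 * m ∎)
      where
      open Plan P
      open ≤-Reasoning
      x₁ x₂ x₃ : ℕ
      x₁ = extra K σ₁ (C₁ zero)
      x₂ = extra K σ₂ (C₂ zero)
      x₃ = extra K σ₃ (C₃ zero)
      separate : ∀ s₁ s₂ s₃ x₁ x₂ x₃ →
        27 * ((s₁ + x₁) + (s₂ + x₂) + (s₃ + x₃)) ≡ 27 * (s₁ + s₂ + s₃) + 27 * (x₁ + x₂ + x₃)
      separate = solve-∀
      recombine : ∀ r K → 44 * suc r + 44 * (3 + K) ≡ 44 * ((2 + K) + (2 + r))
      recombine = solve-∀

    K≥1 : 3 ≤ k → 1 ≤ K
    K≥1 3≤k = s≤s⁻¹ (s≤s⁻¹ (subst (3 ≤_) (sym parallel-count) 3≤k))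

lemma21 : ∀ {n m} (G : Graph (suc (suc n)) m) (v₁ v₂ : Fin (suc (suc n))) (k : ℕ)
          (v₁≢v₂ : v₁ ≢ v₂) →
          Bridgeless G →
          3 ≤ k →
          multiplicity G v₁ v₂ ≡ k →
          degree G v₁ ≡ suc k →
          degree G v₂ ≡ suc k →
          (e₁ e₂ : Fin (length (kept m (λ e → not (joins G v₁ v₂ e))))) →
          e₁ ≢ e₂ →
          Incident (contractBetween G v₁ v₂ v₁≢v₂) (merge v₁ v₂ v₁≢v₂ v₁) e₁ →
          Incident (contractBetween G v₁ v₂ v₁≢v₂) (merge v₁ v₂ v₁≢v₂ v₁) e₂ →
          (u≢w : otherEnd (contractBetween G v₁ v₂ v₁≢v₂) (merge v₁ v₂ v₁≢v₂ v₁) e₁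
                 ≢ merge v₁ v₂ v₁≢v₂ v₁) →
          HasCover3 (suppress (contractBetween G v₁ v₂ v₁≢v₂) (merge v₁ v₂ v₁≢v₂ v₁) e₁ e₂ u≢w)
                    (44 * (m ∸ k ∸ 1)) →
          HasCover3 G (44 * m)
lemma21 {m = m} G v₁ v₂ k v₁≢v₂ _ 3≤k mult deg₁ deg₂ e₁ e₂ e₁≢e₂ I₁ I₂ u≢w
        (C₁ , C₂ , C₃ , cycle₁ , cycle₂ , cycle₃ , covered , short) =
  lift-along (two-witnesses m par (≤-trans (n≤1+n 2) (subst (3 ≤_) (sym mult) 3≤k)))
  where
  open Reduction G v₁ v₂ k v₁≢v₂ mult deg₁ deg₂ e₁ e₂ e₁≢e₂ I₁ I₂ u≢w
  lift-along : Σ[ a ∈ Fin m ] Σ[ b ∈ Fin m ] a ≢ b × par a ≡ true × par b ≡ true → HasCover3 G (44 * m)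
  lift-along (a , b , a≢b , par-a , par-b) =
    lift-cover C₁ C₂ C₃ cycle₁ cycle₂ cycle₃ covered short
      (plan K (K≥1 3≤k) (C₁ zero) (C₂ zero) (C₃ zero) (covered zero))
    where open Lifting a b a≢b par-a par-b
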